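{- Let $G_1,G_2$ be finite simple connected graphs, $G_i$ having $n_i$ vertices and $m_i$ edges. Then the corona product $G_1\odot G_2$ satisfies \[F(G_1\odot G_2)=F(G_1)+n_1F(G_2)+3n_2M_1(G_1)+3n_1M_1(G_2)+6n_2^2m_1+6n_1m_2+n_1n_2(n_2^2+1).\]
   Context: The corona product $G_1\odot G_2$ is obtained by taking one copy of $G_1$ (with vertices $v_1,\ldots,v_{n_1}$) and $n_1$ vertex-disjoint copies of $G_2$, and joining each vertex of the $i$-th copy of $G_2$ to the vertex $v_i$ of $G_1$, for $1\le i\le n_1$. For a finite simple graph $G$ with vertex degrees $d_G(v)$: $M_1(G)=\sum_{v} d_G(v)^2$ and $F(G)=\sum_{v} d_G(v)^3$. -}

module Defs where

open import Data.Nat using (ℕ; zero; suc; _+_; _*_; _^_; _<ᵇ_)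
open import Data.Bool using (Bool; true; false; _∧_; if_then_else_)

open import Data.Fin using (Fin; toℕ; splitAt; remQuot)
open import Data.Fin.Properties using (_≟_)
open import Data.List using (List; map; allFin)
open import Data.Nat.ListAction using (sum)
open import Data.Sum using (_⊎_; inj₁; inj₂)
open import Data.Product using (_×_; _,_)
open import Relation.Nullary using (does)
open import Relation.Nullary.Decidable using (yes; no)
open import Relation.Binary.PropositionalEquality using (_≡_; refl; sym; cong₂)

record SimpleGraph (n : ℕ) : Set where
  field
    adj    : Fin n → Fin n → Bool
    adj-sym : ∀ i j → adj i j ≡ adj j i
    irrefl : ∀ i → adj i i ≡ false
open SimpleGraph public

Σv : ∀ {n} → (Fin n → ℕ) → ℕ
Σv {n} f = sum (map f (allFin n))

b2n : Bool → ℕ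
b2n true  = 1
b2n false = 0

deg : ∀ {n} → SimpleGraph n → Fin n → ℕ
deg G i = Σv (λ j → b2n (adj G i j))

edges : ∀ {n} → SimpleGraph n → ℕ
edges G = Σv (λ i → Σv (λ j → b2n ((toℕ i <ᵇ toℕ j) ∧ adj G i j)))

M₁ : ∀ {n} → SimpleGraph n → ℕ
M₁ G = Σv (λ i → deg G i ^ 2)

F : ∀ {n} → SimpleGraph n → ℕ
F G = Σv (λ i → deg G i ^ 3)

data Walk {n} (G : SimpleGraph n) : Fin n → Fin n → Set where
  here : ∀ {i} → Walk G i i
  step : ∀ {i j k} → adj G i j ≡ true → Walk G j k → Walk G i k

Connected : ∀ {n} → SimpleGraph n → Set
Connected {n} G = ∀ (i j : Fin n) → Walk G i j

-- Corona product. Vertices of G₁ ⊙ G₂: Fin (n₁ + n₁ * n₂), decoded as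
-- inj₁ v  (vertex v of G₁)  or  inj₂ (i , x)  (vertex x of the i-th copy of G₂).
eqF : ∀ {n} → Fin n → Fin n → Bool
eqF a b = does (a ≟ b)

eqF-sym : ∀ {n} (a b : Fin n) → eqF a b ≡ eqF b a
eqF-sym a b with a ≟ b | b ≟ a
... | yes _ | yes _ = refl
... | no _  | no _  = refl
... | yes p | no q  with q (sym p)
... | ()
eqF-sym a b | no p | yes q with p (sym q)
... | ()

eqF-refl : ∀ {n} (a : Fin n) → eqF a a ≡ true
eqF-refl a with a ≟ a
... | yes _ = refl
... | no p with p refl
... | ()

coronaAdjS : ∀ {n₁ n₂} → SimpleGraph n₁ → SimpleGraph n₂ →
             Fin n₁ ⊎ (Fin n₁ × Fin n₂) → Fin n₁ ⊎ (Fin n₁ × Fin n₂) → Bool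
coronaAdjS G₁ G₂ (inj₁ a)       (inj₁ b)       = adj G₁ a b
coronaAdjS G₁ G₂ (inj₁ a)       (inj₂ (i , x)) = eqF a i
coronaAdjS G₁ G₂ (inj₂ (i , x)) (inj₁ a)       = eqF i a
coronaAdjS G₁ G₂ (inj₂ (i , x)) (inj₂ (j , y)) = eqF i j ∧ adj G₂ x y

coronaAdjS-sym : ∀ {n₁ n₂} (G₁ : SimpleGraph n₁) (G₂ : SimpleGraph n₂) u v →
                 coronaAdjS G₁ G₂ u v ≡ coronaAdjS G₁ G₂ v u
coronaAdjS-sym G₁ G₂ (inj₁ a)       (inj₁ b)       = adj-sym G₁ a b
coronaAdjS-sym G₁ G₂ (inj₁ a)       (inj₂ (i , x)) = eqF-sym a i
coronaAdjS-sym G₁ G₂ (inj₂ (i , x)) (inj₁ a)       = eqF-sym i a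
coronaAdjS-sym G₁ G₂ (inj₂ (i , x)) (inj₂ (j , y)) =
  cong₂ _∧_ (eqF-sym i j) (adj-sym G₂ x y)

coronaAdjS-irrefl : ∀ {n₁ n₂} (G₁ : SimpleGraph n₁) (G₂ : SimpleGraph n₂) u →
                    coronaAdjS G₁ G₂ u u ≡ false
coronaAdjS-irrefl G₁ G₂ (inj₁ a) = irrefl G₁ a
coronaAdjS-irrefl G₁ G₂ (inj₂ (i , x)) rewrite eqF-refl i = irrefl G₂ x

decode : ∀ n₁ n₂ → Fin (n₁ + n₁ * n₂) → Fin n₁ ⊎ (Fin n₁ × Fin n₂)
decode n₁ n₂ v with splitAt n₁ v
... | inj₁ a = inj₁ a
... | inj₂ w = inj₂ (remQuot n₂ w)

corona : ∀ {n₁ n₂} → SimpleGraph n₁ → SimpleGraph n₂ → SimpleGraph (n₁ + n₁ * n₂)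
corona {n₁} {n₂} G₁ G₂ = record
  { adj    = λ u v → coronaAdjS G₁ G₂ (decode n₁ n₂ u) (decode n₁ n₂ v)
  ; adj-sym = λ u v → coronaAdjS-sym G₁ G₂ (decode n₁ n₂ u) (decode n₁ n₂ v)
  ; irrefl = λ u → coronaAdjS-irrefl G₁ G₂ (decode n₁ n₂ u)
  }

_⊙_ : ∀ {n₁ n₂} → SimpleGraph n₁ → SimpleGraph n₂ → SimpleGraph (n₁ + n₁ * n₂)
_⊙_ = corona

module Submission where

-- In G₁ ⊙ G₂ a vertex a of G₁ keeps its neighbours in G₁ and gains the n₂
-- vertices of its own copy of G₂, while a vertex x of a copy of G₂ keeps its
-- neighbours in that copy and gains exactly one more, the vertex of G₁ the
-- copy hangs from.  Hence
--   F (G₁ ⊙ G₂) = Σₐ (d₁ a + n₂)³ + n₁ · Σₓ (d₂ x + 1)³.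
-- Expanding a shifted cube and using the handshake lemma Σᵥ d v = 2m gives,
-- for every graph G on n vertices and every constant c,
--   Σᵥ (d v + c)³ = F G + 3c·M₁ G + 6c²·m + n·c³,
-- and the theorem follows by taking c = n₂ for G₁, c = 1 for G₂ and
-- collecting terms.

open import Defs
open import Data.Nat using (ℕ; zero; suc; _+_; _*_; _^_; _<ᵇ_; _<_)
open import Data.Nat.Properties
  using (+-*-semiring; +-assoc; +-comm; *-comm; +-identityʳ; *-identityʳ; <-cmp; <-irrefl; _<?_)
open import Data.Nat.Solver using (module +-*-Solver)
open +-*-Solver using (solve; _:+_; _:*_; _:^_; _:=_; con)
open import Data.Bool using (true; false; _∧_)
open import Data.Fin using (Fin; toℕ; _↑ˡ_; _↑ʳ_; combine; punchIn)
open import Data.Fin.Properties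
  using (_≟_; splitAt-↑ˡ; splitAt-↑ʳ; remQuot-combine; toℕ-injective; punchInᵢ≢i)
open import Data.List using (map; tabulate)
import Data.Nat.ListAction as List
open import Data.Sum using (_⊎_; inj₁; inj₂)
open import Data.Product using (_×_; _,_)
open import Relation.Binary using (tri<; tri≈; tri>)
open import Relation.Nullary using (¬_)
open import Relation.Nullary.Decidable using (dec-true; dec-false)
open import Relation.Binary.PropositionalEquality
open ≡-Reasoning

open import Algebra.Properties.Semiring.Sum +-*-semiring
  using (sum-syntax; sum-cong-≗; ∑-distrib-+; ∑-comm; *-distribˡ-sum;
         sum-remove; sum-replicate-zero)

Σv-as-∑ : ∀ {n} (f : Fin n → ℕ) → Σv f ≡ ∑[ i < n ] f i
Σv-as-∑ {n} f = sum-map-tabulate n (λ i → i)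
  where
  sum-map-tabulate : ∀ {A : Set} k (g : Fin k → A) {h : A → ℕ} →
    List.sum (map h (tabulate g)) ≡ ∑[ i < k ] h (g i)
  sum-map-tabulate zero    g = refl
  sum-map-tabulate (suc k) g = cong (_ +_) (sum-map-tabulate k (λ i → g (Fin.suc i)))

∑-const : ∀ n c → ∑[ i < n ] c ≡ n * c
∑-const zero    c = refl
∑-const (suc n) c = cong (c +_) (∑-const n c)

∑-++ : ∀ m n (f : Fin (m + n) → ℕ) →
  ∑[ k < m + n ] f k ≡ ∑[ i < m ] f (i ↑ˡ n) + ∑[ j < n ] f (m ↑ʳ j)
∑-++ zero    n f = refl
∑-++ (suc m) n f =
  trans (cong (f Fin.zero +_) (∑-++ m n (λ k → f (Fin.suc k))))
        (sym (+-assoc (f Fin.zero) (∑[ i < m ] f (Fin.suc i ↑ˡ n)) (∑[ j < n ] f (suc m ↑ʳ j))))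

∑-combine : ∀ m n (f : Fin (m * n) → ℕ) →
  ∑[ k < m * n ] f k ≡ ∑[ i < m ] ∑[ j < n ] f (combine i j)
∑-combine zero    n f = refl
∑-combine (suc m) n f =
  trans (∑-++ n (m * n) f) (cong (∑[ j < n ] f (j ↑ˡ m * n) +_) (∑-combine m n (λ k → f (n ↑ʳ k))))

∑-indicator : ∀ n (i : Fin n) (g : Fin n → ℕ) → ∑[ j < n ] (b2n (eqF i j) * g j) ≡ g i
∑-indicator (suc n) i g = begin
  ∑[ j < suc n ] t j                ≡⟨ sum-remove {i = i} t ⟩
  t i + ∑[ j < n ] t (punchIn i j)  ≡⟨ cong₂ _+_ t-at-i (sum-cong-≗ t-off-i) ⟩
  (g i + 0) + ∑[ j < n ] 0          ≡⟨ cong₂ _+_ (+-identityʳ (g i)) (sum-replicate-zero n) ⟩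
  g i + 0                           ≡⟨ +-identityʳ (g i) ⟩
  g i                               ∎
  where
  -- The summand; every index other than i is of the form punchIn i j.
  t : Fin (suc n) → ℕ
  t j = b2n (eqF i j) * g j
  t-at-i : t i ≡ g i + 0
  t-at-i = cong (λ b → b2n b * g i) (eqF-refl i)
  t-off-i : ∀ j → t (punchIn i j) ≡ 0
  t-off-i j = cong (λ b → b2n b * g (punchIn i j))
                   (dec-false (i ≟ punchIn i j) (λ eq → punchInᵢ≢i i j (sym eq)))

<ᵇ-true : ∀ {m n} → m < n → (m <ᵇ n) ≡ true
<ᵇ-true {m} {n} m<n = dec-true (m <? n) m<n

<ᵇ-false : ∀ {m n} → ¬ m < n → (m <ᵇ n) ≡ false
<ᵇ-false {m} {n} m≮n = dec-false (m <? n) m≮n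

module _ {n} (G : SimpleGraph n) where

  orderedEdge : Fin n → Fin n → ℕ
  orderedEdge i j = b2n ((toℕ i <ᵇ toℕ j) ∧ adj G i j)

  adj-as-orderedEdges : ∀ i j → b2n (adj G i j) ≡ orderedEdge i j + orderedEdge j i
  adj-as-orderedEdges i j with <-cmp (toℕ i) (toℕ j)
  ... | tri< i<j _ j≮i rewrite <ᵇ-true i<j | <ᵇ-false j≮i = sym (+-identityʳ _)
  ... | tri> i≮j _ j<i rewrite <ᵇ-false i≮j | <ᵇ-true j<i = cong b2n (adj-sym G i j)
  ... | tri≈ _ i≡j _ rewrite toℕ-injective i≡j | <ᵇ-false (<-irrefl {toℕ j} refl) | irrefl G j = refl

  handshake : ∑[ i < n ] deg G i ≡ 2 * edges G
  handshake = begin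
    ∑[ i < n ] deg G i
      ≡⟨ sum-cong-≗ (λ i → Σv-as-∑ (λ j → b2n (adj G i j))) ⟩
    ∑[ i < n ] ∑[ j < n ] b2n (adj G i j)
      ≡⟨ sum-cong-≗ (λ i → sum-cong-≗ (adj-as-orderedEdges i)) ⟩
    ∑[ i < n ] ∑[ j < n ] (orderedEdge i j + orderedEdge j i)
      ≡⟨ sum-cong-≗ (λ i → ∑-distrib-+ (orderedEdge i) (λ j → orderedEdge j i)) ⟩
    ∑[ i < n ] (∑[ j < n ] orderedEdge i j + ∑[ j < n ] orderedEdge j i)
      ≡⟨ ∑-distrib-+ (λ i → ∑[ j < n ] orderedEdge i j) (λ i → ∑[ j < n ] orderedEdge j i) ⟩
    E + ∑[ i < n ] ∑[ j < n ] orderedEdge j i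
      ≡⟨ cong (E +_) (∑-comm (λ i j → orderedEdge j i)) ⟩
    E + E
      ≡⟨ cong (E +_) (sym (+-identityʳ E)) ⟩
    2 * E
      ≡⟨ cong (2 *_) E≡edges ⟩
    2 * edges G ∎
    where
    E : ℕ
    E = ∑[ i < n ] ∑[ j < n ] orderedEdge i j
    E≡edges : E ≡ edges G
    E≡edges = sym (trans (Σv-as-∑ (λ i → Σv (orderedEdge i)))
                         (sum-cong-≗ (λ i → Σv-as-∑ (orderedEdge i))))

cube-of-sum : ∀ x c → (x + c) ^ 3 ≡ x ^ 3 + 3 * c * x ^ 2 + 3 * c ^ 2 * x + c ^ 3
cube-of-sum = solve 2 (λ x c → (x :+ c) :^ 3 :=
  x :^ 3 :+ con 3 :* c :* x :^ 2 :+ con 3 :* c :^ 2 :* x :+ c :^ 3) refl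

∑-shifted-cube : ∀ n (d : Fin n → ℕ) c →
  ∑[ i < n ] ((d i + c) ^ 3)
    ≡ ∑[ i < n ] (d i ^ 3) + 3 * c * ∑[ i < n ] (d i ^ 2) + 3 * c ^ 2 * ∑[ i < n ] d i + n * c ^ 3
∑-shifted-cube n d c = begin
  ∑[ i < n ] ((d i + c) ^ 3)
    ≡⟨ sum-cong-≗ (λ i → cube-of-sum (d i) c) ⟩
  ∑[ i < n ] (cubes i + sqs i + lin i + c ^ 3)
    ≡⟨ ∑-distrib-+ (λ i → cubes i + sqs i + lin i) (λ _ → c ^ 3) ⟩
  ∑[ i < n ] (cubes i + sqs i + lin i) + ∑[ i < n ] (c ^ 3)
    ≡⟨ cong₂ _+_ (∑-distrib-+ (λ i → cubes i + sqs i) lin) (∑-const n (c ^ 3)) ⟩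
  ∑[ i < n ] (cubes i + sqs i) + ∑[ i < n ] lin i + n * c ^ 3
    ≡⟨ cong (λ s → s + ∑[ i < n ] lin i + n * c ^ 3) (∑-distrib-+ cubes sqs) ⟩
  ∑[ i < n ] cubes i + ∑[ i < n ] sqs i + ∑[ i < n ] lin i + n * c ^ 3
    ≡⟨ cong₂ (λ s t → ∑[ i < n ] cubes i + s + t + n * c ^ 3)
             (sym (*-distribˡ-sum (3 * c) (λ i → d i ^ 2)))
             (sym (*-distribˡ-sum (3 * c ^ 2) d)) ⟩
  ∑[ i < n ] (d i ^ 3) + 3 * c * ∑[ i < n ] (d i ^ 2) + 3 * c ^ 2 * ∑[ i < n ] d i + n * c ^ 3 ∎
  where
  cubes sqs lin : Fin n → ℕ
  cubes i = d i ^ 3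
  sqs   i = 3 * c * d i ^ 2
  lin   i = 3 * c ^ 2 * d i

shifted-forgotten : ∀ {n} (G : SimpleGraph n) c →
  ∑[ v < n ] ((deg G v + c) ^ 3) ≡ F G + 3 * c * M₁ G + 6 * c ^ 2 * edges G + n * c ^ 3
shifted-forgotten {n} G c = begin
  ∑[ v < n ] ((deg G v + c) ^ 3)
    ≡⟨ ∑-shifted-cube n (deg G) c ⟩
  ∑[ v < n ] (deg G v ^ 3) + 3 * c * ∑[ v < n ] (deg G v ^ 2) + 3 * c ^ 2 * ∑[ v < n ] deg G v + n * c ^ 3
    ≡⟨ cong₂ (λ f m → f + 3 * c * m + 3 * c ^ 2 * ∑[ v < n ] deg G v + n * c ^ 3)
             (sym (Σv-as-∑ (λ v → deg G v ^ 3))) (sym (Σv-as-∑ (λ v → deg G v ^ 2))) ⟩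
  F G + 3 * c * M₁ G + 3 * c ^ 2 * ∑[ v < n ] deg G v + n * c ^ 3
    ≡⟨ cong (λ s → F G + 3 * c * M₁ G + 3 * c ^ 2 * s + n * c ^ 3) (handshake G) ⟩
  F G + 3 * c * M₁ G + 3 * c ^ 2 * (2 * edges G) + n * c ^ 3
    ≡⟨ cong (λ s → F G + 3 * c * M₁ G + s + n * c ^ 3) (regroup (c ^ 2) (edges G)) ⟩
  F G + 3 * c * M₁ G + 6 * c ^ 2 * edges G + n * c ^ 3 ∎
  where
  regroup : ∀ x e → 3 * x * (2 * e) ≡ 6 * x * e
  regroup = solve 2 (λ x e → con 3 :* x :* (con 2 :* e) := con 6 :* x :* e) refl

∑-decode : ∀ n₁ n₂ (h : Fin n₁ ⊎ (Fin n₁ × Fin n₂) → ℕ) →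
  ∑[ v < n₁ + n₁ * n₂ ] h (decode n₁ n₂ v)
    ≡ ∑[ a < n₁ ] h (inj₁ a) + ∑[ i < n₁ ] ∑[ x < n₂ ] h (inj₂ (i , x))
∑-decode n₁ n₂ h = begin
  ∑[ v < n₁ + n₁ * n₂ ] h (decode n₁ n₂ v)
    ≡⟨ ∑-++ n₁ (n₁ * n₂) (λ v → h (decode n₁ n₂ v)) ⟩
  ∑[ a < n₁ ] h (decode n₁ n₂ (a ↑ˡ n₁ * n₂)) + ∑[ w < n₁ * n₂ ] h (decode n₁ n₂ (n₁ ↑ʳ w))
    ≡⟨ cong₂ _+_ (sum-cong-≗ (λ a → cong h (decode-hub a)))
                 (∑-combine n₁ n₂ (λ w → h (decode n₁ n₂ (n₁ ↑ʳ w)))) ⟩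
  ∑[ a < n₁ ] h (inj₁ a) + ∑[ i < n₁ ] ∑[ x < n₂ ] h (decode n₁ n₂ (n₁ ↑ʳ combine i x))
    ≡⟨ cong (∑[ a < n₁ ] h (inj₁ a) +_)
            (sum-cong-≗ (λ i → sum-cong-≗ (λ x → cong h (decode-copy i x)))) ⟩
  ∑[ a < n₁ ] h (inj₁ a) + ∑[ i < n₁ ] ∑[ x < n₂ ] h (inj₂ (i , x)) ∎
  where
  decode-hub : ∀ a → decode n₁ n₂ (a ↑ˡ n₁ * n₂) ≡ inj₁ a
  decode-hub a rewrite splitAt-↑ˡ n₁ a (n₁ * n₂) = refl
  decode-copy : ∀ i x → decode n₁ n₂ (n₁ ↑ʳ combine i x) ≡ inj₂ (i , x)
  decode-copy i x rewrite splitAt-↑ʳ n₁ (n₁ * n₂) (combine i x)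
                        | remQuot-combine {n₁} {n₂} i x = refl

b2n-∧ : ∀ a b → b2n (a ∧ b) ≡ b2n a * b2n b
b2n-∧ true  b = sym (+-identityʳ (b2n b))
b2n-∧ false b = refl

module _ {n₁ n₂} (G₁ : SimpleGraph n₁) (G₂ : SimpleGraph n₂) where

  -- The degree in G₁ ⊙ G₂ of a vertex, given in decoded form: a vertex of G₁
  -- gains the n₂ vertices of its copy, a copy vertex gains its hub.
  coronaDeg : Fin n₁ ⊎ (Fin n₁ × Fin n₂) → ℕ
  coronaDeg (inj₁ a)       = deg G₁ a + n₂
  coronaDeg (inj₂ (i , x)) = deg G₂ x + 1

  neighbour-count : ∀ s →
    ∑[ b < n₁ ] b2n (coronaAdjS G₁ G₂ s (inj₁ b))
      + ∑[ j < n₁ ] ∑[ y < n₂ ] b2n (coronaAdjS G₁ G₂ s (inj₂ (j , y)))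
    ≡ coronaDeg s
  neighbour-count (inj₁ a) = cong₂ _+_ (sym (Σv-as-∑ (λ b → b2n (adj G₁ a b)))) (begin
    ∑[ j < n₁ ] ∑[ y < n₂ ] b2n (eqF a j)
      ≡⟨ sum-cong-≗ (λ j → trans (∑-const n₂ (b2n (eqF a j))) (*-comm n₂ (b2n (eqF a j)))) ⟩
    ∑[ j < n₁ ] (b2n (eqF a j) * n₂)
      ≡⟨ ∑-indicator n₁ a (λ _ → n₂) ⟩
    n₂ ∎)
  neighbour-count (inj₂ (i , x)) = trans (cong₂ _+_ hub copy) (+-comm 1 (deg G₂ x))
    where
    hub : ∑[ b < n₁ ] b2n (eqF i b) ≡ 1
    hub = trans (sum-cong-≗ (λ b → sym (*-identityʳ (b2n (eqF i b))))) (∑-indicator n₁ i (λ _ → 1))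
    copy : ∑[ j < n₁ ] ∑[ y < n₂ ] b2n (eqF i j ∧ adj G₂ x y) ≡ deg G₂ x
    copy = begin
      ∑[ j < n₁ ] ∑[ y < n₂ ] b2n (eqF i j ∧ adj G₂ x y)
        ≡⟨ sum-cong-≗ (λ j → sum-cong-≗ (λ y → b2n-∧ (eqF i j) (adj G₂ x y))) ⟩
      ∑[ j < n₁ ] ∑[ y < n₂ ] (b2n (eqF i j) * b2n (adj G₂ x y))
        ≡⟨ sum-cong-≗ (λ j → sym (*-distribˡ-sum (b2n (eqF i j)) (λ y → b2n (adj G₂ x y)))) ⟩
      ∑[ j < n₁ ] (b2n (eqF i j) * ∑[ y < n₂ ] b2n (adj G₂ x y))
        ≡⟨ ∑-indicator n₁ i (λ _ → ∑[ y < n₂ ] b2n (adj G₂ x y)) ⟩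
      ∑[ y < n₂ ] b2n (adj G₂ x y)
        ≡⟨ sym (Σv-as-∑ (λ y → b2n (adj G₂ x y))) ⟩
      deg G₂ x ∎

  deg-corona : ∀ v → deg (G₁ ⊙ G₂) v ≡ coronaDeg (decode n₁ n₂ v)
  deg-corona v = begin
    deg (G₁ ⊙ G₂) v
      ≡⟨ Σv-as-∑ (λ w → b2n (coronaAdjS G₁ G₂ s (decode n₁ n₂ w))) ⟩
    ∑[ w < n₁ + n₁ * n₂ ] b2n (coronaAdjS G₁ G₂ s (decode n₁ n₂ w))
      ≡⟨ ∑-decode n₁ n₂ (λ t → b2n (coronaAdjS G₁ G₂ s t)) ⟩
    ∑[ b < n₁ ] b2n (coronaAdjS G₁ G₂ s (inj₁ b))
      + ∑[ j < n₁ ] ∑[ y < n₂ ] b2n (coronaAdjS G₁ G₂ s (inj₂ (j , y)))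
      ≡⟨ neighbour-count s ⟩
    coronaDeg s ∎
    where
    s : Fin n₁ ⊎ (Fin n₁ × Fin n₂)
    s = decode n₁ n₂ v

  forgotten-corona :
    F (G₁ ⊙ G₂) ≡ ∑[ a < n₁ ] ((deg G₁ a + n₂) ^ 3) + n₁ * ∑[ x < n₂ ] ((deg G₂ x + 1) ^ 3)
  forgotten-corona = begin
    F (G₁ ⊙ G₂)
      ≡⟨ Σv-as-∑ (λ v → deg (G₁ ⊙ G₂) v ^ 3) ⟩
    ∑[ v < n₁ + n₁ * n₂ ] (deg (G₁ ⊙ G₂) v ^ 3)
      ≡⟨ sum-cong-≗ (λ v → cong (_^ 3) (deg-corona v)) ⟩
    ∑[ v < n₁ + n₁ * n₂ ] (coronaDeg (decode n₁ n₂ v) ^ 3)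
      ≡⟨ ∑-decode n₁ n₂ (λ s → coronaDeg s ^ 3) ⟩
    ∑[ a < n₁ ] ((deg G₁ a + n₂) ^ 3) + ∑[ i < n₁ ] ∑[ x < n₂ ] ((deg G₂ x + 1) ^ 3)
      ≡⟨ cong (∑[ a < n₁ ] ((deg G₁ a + n₂) ^ 3) +_) (∑-const n₁ (∑[ x < n₂ ] ((deg G₂ x + 1) ^ 3))) ⟩
    ∑[ a < n₁ ] ((deg G₁ a + n₂) ^ 3) + n₁ * ∑[ x < n₂ ] ((deg G₂ x + 1) ^ 3) ∎

theorem8 : ∀ {n₁ n₂ : ℕ} (G₁ : SimpleGraph n₁) (G₂ : SimpleGraph n₂) →
    Connected G₁ → Connected G₂ →
    F (G₁ ⊙ G₂) ≡ F G₁ + n₁ * F G₂ + 3 * n₂ * M₁ G₁ + 3 * n₁ * M₁ G₂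
      + 6 * n₂ ^ 2 * edges G₁ + 6 * n₁ * edges G₂ + n₁ * n₂ * (n₂ ^ 2 + 1)
theorem8 {n₁} {n₂} G₁ G₂ _ _ = begin
  F (G₁ ⊙ G₂)
    ≡⟨ forgotten-corona G₁ G₂ ⟩
  ∑[ a < n₁ ] ((deg G₁ a + n₂) ^ 3) + n₁ * ∑[ x < n₂ ] ((deg G₂ x + 1) ^ 3)
    ≡⟨ cong₂ (λ s t → s + n₁ * t) (shifted-forgotten G₁ n₂) (shifted-forgotten G₂ 1) ⟩
  (F G₁ + 3 * n₂ * M₁ G₁ + 6 * n₂ ^ 2 * edges G₁ + n₁ * n₂ ^ 3)
    + n₁ * (F G₂ + 3 * 1 * M₁ G₂ + 6 * 1 ^ 2 * edges G₂ + n₂ * 1 ^ 3)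
    ≡⟨ collect (F G₁) (M₁ G₁) (edges G₁) (F G₂) (M₁ G₂) (edges G₂) n₁ n₂ ⟩
  F G₁ + n₁ * F G₂ + 3 * n₂ * M₁ G₁ + 3 * n₁ * M₁ G₂
    + 6 * n₂ ^ 2 * edges G₁ + 6 * n₁ * edges G₂ + n₁ * n₂ * (n₂ ^ 2 + 1) ∎
  where
  collect : ∀ f₁ z₁ e₁ f₂ z₂ e₂ n₁ n₂ →
    (f₁ + 3 * n₂ * z₁ + 6 * n₂ ^ 2 * e₁ + n₁ * n₂ ^ 3)
      + n₁ * (f₂ + 3 * 1 * z₂ + 6 * 1 ^ 2 * e₂ + n₂ * 1 ^ 3)
    ≡ f₁ + n₁ * f₂ + 3 * n₂ * z₁ + 3 * n₁ * z₂
      + 6 * n₂ ^ 2 * e₁ + 6 * n₁ * e₂ + n₁ * n₂ * (n₂ ^ 2 + 1)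
  collect = solve 8 (λ f₁ z₁ e₁ f₂ z₂ e₂ n₁ n₂ →
    (f₁ :+ con 3 :* n₂ :* z₁ :+ con 6 :* n₂ :^ 2 :* e₁ :+ n₁ :* n₂ :^ 3)
      :+ n₁ :* (f₂ :+ con 3 :* con 1 :* z₂ :+ con 6 :* con 1 :^ 2 :* e₂ :+ n₂ :* con 1 :^ 3)
    := f₁ :+ n₁ :* f₂ :+ con 3 :* n₂ :* z₁ :+ con 3 :* n₁ :* z₂
      :+ con 6 :* n₂ :^ 2 :* e₁ :+ con 6 :* n₁ :* e₂ :+ n₁ :* n₂ :* (n₂ :^ 2 :+ con 1)) refl
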